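{- The mean number of summands in the Kentucky-2 legal decompositions of the integers in $[0,a_{2n+1})$ (each integer weighted equally) is \[ \mu_n=\frac n3+\frac29+O\!\left(\frac{n}{2^n}\right). \]
   Context: The Kentucky-2 sequence $(a_n)_{n\ge1}$: index $\ell$ belongs to bin $\lceil \ell/2\rceil$. A legal decomposition of $m\ge0$ using $\{a_1,\dots,a_N\}$ is $m=a_{\ell_1}+\cdots+a_{\ell_k}$, $k\ge0$, $1\le\ell_1<\cdots<\ell_k\le N$, with $\lceil \ell_{j+1}/2\rceil-\lceil \ell_j/2\rceil\ge2$ for all $j$. The sequence is defined by $a_1=1$ and, for $N\ge1$, $a_{N+1}$ is the smallest positive integer with no legal decomposition using $\{a_1,\dots,a_N\}$ (first terms $1,2,3,4,5,8,11,16,\dots$). Every nonnegative integer has a unique legal decomposition (that of $0$ has $0$ summands). -}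

module Defs where

open import Data.Nat using (ℕ; zero; suc; _+_; _*_; _≤_; _<_; ⌈_/2⌉)
open import Data.Integer using (+_)
open import Data.Rational using (ℚ; _/_; 0ℚ)
open import Data.List using (List; map)
open import Data.Nat.ListAction using (sum)
open import Data.List.Relation.Unary.All using (All)
open import Data.List.Relation.Unary.Linked using (Linked)
open import Data.Product using (_×_; Σ)
open import Relation.Binary.PropositionalEquality using (_≡_)
open import Relation.Nullary using (¬_)

bin : ℕ → ℕ
bin ℓ = ⌈ ℓ /2⌉

Gap : ℕ → ℕ → Set
Gap ℓ ℓ' = (ℓ < ℓ') × (2 + bin ℓ ≤ bin ℓ')

LegalDecomp : (ℕ → ℕ) → ℕ → ℕ → List ℕ → Set
LegalDecomp a N m ls =
  All (λ ℓ → (1 ≤ ℓ) × (ℓ ≤ N)) ls × Linked Gap ls × (sum (map a ls) ≡ m)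

HasLegalDecomp : (ℕ → ℕ) → ℕ → ℕ → Set
HasLegalDecomp a N m = Σ (List ℕ) (LegalDecomp a N m)

-- a is the Kentucky-2 sequence (indexed from 1; the value a 0 is irrelevant):
-- a₁ = 1, and for N ≥ 1, a_{N+1} is the smallest positive integer with no
-- legal decomposition using {a₁, …, a_N}.
IsKentucky2 : (ℕ → ℕ) → Set
IsKentucky2 a =
  (a 1 ≡ 1) ×
  (∀ N → 1 ≤ N →
     (1 ≤ a (suc N))
     × ¬ HasLegalDecomp a N (a (suc N))
     × (∀ x → 1 ≤ x → x < a (suc N) → HasLegalDecomp a N x))

-- p / q as a rational number (with the convention p / 0 = 0; only used with q > 0)
_//_ : ℕ → ℕ → ℚ
p // zero = 0ℚ
p // suc q = (+ p) / suc q

-- Let cap j be the number of integers with a legal decomposition using bins < j.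
-- A decomposition with bins < j + 2 either avoids bin j + 1, or it is one with
-- bins < j topped by one of the two terms cap (j + 1), cap (j + 1) + cap j of
-- bin j + 1 (TopView); hence cap (j + 2) = cap (j + 1) + 2 cap j.  By induction
-- along this recursion, decompositions with bins < j have value < cap j, every
-- m < cap j has one, and its number of summands is the greedily computed
-- summands j m.  The first two facts identify the Kentucky-2 sequence with the
-- explicit sequence kent (agree), so a₂ₙ₊₁ = cap (n + 1).  Splitting [0, cap (j + 2))
-- into the same three blocks yields a recursion for total j = Σ_{m < cap j} summands j m
-- and the closed form 9 · total (n + 1) = (3n + 2) · cap (n + 1) ± (n + 2).  Dividing
-- by 9 · cap (n + 1) ≥ 9 · 2ⁿ (a rational computation) gives the bound with constant 1.
module Submission where

open import Defs
open import Data.Nat using (ℕ; suc; _+_; _*_; _^_; _≤_)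
open import Data.Rational using (ℚ; ∣_∣; _-_) renaming (_+_ to _+ℚ_; _*_ to _*ℚ_; _≤_ to _≤ℚ_)
open import Data.List using (List; map; upTo; length)
open import Data.Nat.ListAction using (sum)
open import Data.Product using (Σ; _×_; ∃)
open import Relation.Binary.PropositionalEquality using (_≡_)

open import Data.Nat using (zero; _∸_; _<_; z≤n; s≤s; ⌊_/2⌋; _<ᵇ_; _<?_; _≤?_)
open import Data.Nat.Properties
open import Data.Nat.Tactic.RingSolver using (solve-∀)
open import Data.Bool using (true; false; if_then_else_)
open import Data.List using ([]; _∷_; _++_; [_]; applyUpTo)
open import Data.List.Properties using (map-++; length-++; map-cong-local)
open import Data.Nat.ListAction.Properties using (sum-++)
open import Data.List.Relation.Unary.All using (All; []; _∷_)
import Data.List.Relation.Unary.All as All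
import Data.List.Relation.Unary.All.Properties as All
open import Data.List.Relation.Unary.Linked using (Linked; []; [-]; _∷_)
import Data.List.Relation.Unary.Linked as Linked
open import Data.Product using (_,_; proj₁; proj₂)
open import Data.Sum using (_⊎_; inj₁; inj₂)
open import Data.Rational using (1ℚ)
import Data.Rational.Properties as ℚP
open import Function using (_∘_)
open import Relation.Binary using (tri<; tri≈; tri>)
open import Relation.Binary.PropositionalEquality using (refl; sym; trans; cong; cong₂; subst; subst₂; module ≡-Reasoning)
open import Relation.Nullary using (¬_; yes; no; contradiction)
open import Relation.Nullary.Reflects using (ofʸ; ofⁿ)

-- cap j counts the integers with a legal decomposition using bins < j;
-- they form the interval [0, cap j).  (cap 0 = 1 is a convenient seed.)
cap : ℕ → ℕ
cap zero = 1
cap (suc zero) = 1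
cap (suc (suc j)) = cap (suc j) + 2 * cap j

cap-pos : ∀ j → 1 ≤ cap j
cap-pos zero = ≤-refl
cap-pos (suc zero) = ≤-refl
cap-pos (suc (suc j)) = ≤-trans (cap-pos (suc j)) (m≤m+n _ _)

cap-mono : ∀ {i j} → i ≤ j → cap i ≤ cap j
cap-mono {i} {zero} z≤n = ≤-refl
cap-mono {i} {suc j} i≤1+j with m≤n⇒m<n∨m≡n i≤1+j
... | inj₂ refl = ≤-refl
... | inj₁ i<1+j = ≤-trans (cap-mono (≤-pred i<1+j)) (step j)
  where
  step : ∀ j → cap j ≤ cap (suc j)
  step zero = ≤-refl
  step (suc j) = m≤m+n _ _

twice-right : ∀ x y → x + y + y ≡ x + 2 * y
twice-right = solve-∀

pow≤cap : ∀ n → 2 ^ n ≤ cap (suc n)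
pow≤cap zero = ≤-refl
pow≤cap (suc zero) = s≤s (s≤s z≤n)
pow≤cap (suc (suc n)) =
  ≤-trans (≤-reflexive (double (2 ^ n))) (+-mono-≤ (pow≤cap (suc n)) (*-monoʳ-≤ 2 (pow≤cap n)))
  where
  double : ∀ x → 2 * (2 * x) ≡ 2 * x + 2 * x
  double = solve-∀

-- Bin k + 1 consists of the two indices ix₁ k = 2k + 1 and ix₂ k = 2k + 2.
dbl : ℕ → ℕ
dbl zero = 0
dbl (suc k) = suc (suc (dbl k))

ix₁ ix₂ : ℕ → ℕ
ix₁ k = suc (dbl k)
ix₂ k = suc (ix₁ k)

-- Slot k ℓ: the index ℓ lies in bin k + 1.
data Slot : ℕ → ℕ → Set where
  at₁ : ∀ k → Slot k (ix₁ k)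
  at₂ : ∀ k → Slot k (ix₂ k)

slot : ∀ {ℓ} → 1 ≤ ℓ → Σ ℕ λ k → Slot k ℓ
slot {suc zero} _ = 0 , at₁ 0
slot {suc (suc ℓ)} _ = next (proj₂ (slot {suc ℓ} (s≤s z≤n)))
  where
  next : ∀ {k ℓ} → Slot k ℓ → Σ ℕ λ k' → Slot k' (suc ℓ)
  next (at₁ k) = k , at₂ k
  next (at₂ k) = suc k , at₁ (suc k)

half-dbl : ∀ k → ⌊ dbl k /2⌋ ≡ k × ⌊ suc (dbl k) /2⌋ ≡ k
half-dbl zero = refl , refl
half-dbl (suc k) = cong suc (proj₁ (half-dbl k)) , cong suc (proj₂ (half-dbl k))

bin-slot : ∀ {k ℓ} → Slot k ℓ → bin ℓ ≡ suc k
bin-slot (at₁ k) = cong suc (proj₁ (half-dbl k))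
bin-slot (at₂ k) = cong suc (proj₂ (half-dbl k))

slot-pos : ∀ {k ℓ} → Slot k ℓ → 1 ≤ ℓ
slot-pos (at₁ k) = s≤s z≤n
slot-pos (at₂ k) = s≤s z≤n

-- The Kentucky-2 sequence in explicit form: kent (ℓ + 2) exceeds kent (ℓ + 1)
-- by cap ⌊ ℓ / 2 ⌋, the number of values representable with the bins that may
-- precede index ℓ + 1 in a legal decomposition.
kent : ℕ → ℕ
kent zero = 0
kent (suc zero) = 1
kent (suc (suc ℓ)) = kent (suc ℓ) + cap ⌊ ℓ /2⌋

kent-step : ∀ {k ℓ} → Slot k ℓ → kent (suc ℓ) ≡ kent ℓ + cap k
kent-step (at₁ k) = cong (λ h → kent (ix₁ k) + cap h) (proj₁ (half-dbl k))
kent-step (at₂ k) = cong (λ h → kent (ix₂ k) + cap h) (proj₂ (half-dbl k))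

kent-ix₁ : ∀ k → kent (ix₁ k) ≡ cap (suc k)
kent-ix₂ : ∀ k → kent (ix₂ k) ≡ cap (suc k) + cap k
kent-ix₁ zero = refl
kent-ix₁ (suc k) = begin
  kent (suc (ix₂ k))             ≡⟨ kent-step (at₂ k) ⟩
  kent (ix₂ k) + cap k           ≡⟨ cong (_+ cap k) (kent-ix₂ k) ⟩
  cap (suc k) + cap k + cap k    ≡⟨ twice-right (cap (suc k)) (cap k) ⟩
  cap (suc k) + 2 * cap k        ∎
  where open ≡-Reasoning
kent-ix₂ k = trans (kent-step (at₁ k)) (cong (_+ cap k) (kent-ix₁ k))

kent-pos : ∀ {ℓ} → 1 ≤ ℓ → 1 ≤ kent ℓ
kent-pos {suc zero} _ = ≤-refl
kent-pos {suc (suc ℓ)} _ = ≤-trans (kent-pos {suc ℓ} (s≤s z≤n)) (m≤m+n _ _)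

kent-mono : ∀ {i j} → 1 ≤ i → i ≤ j → kent i ≤ kent j
kent-mono {i} {zero} 1≤i i≤0 = contradiction (≤-trans 1≤i i≤0) λ ()
kent-mono {i} {suc j} 1≤i i≤1+j with m≤n⇒m<n∨m≡n i≤1+j
... | inj₂ refl = ≤-refl
... | inj₁ i<1+j with slot (≤-trans 1≤i (≤-pred i<1+j))
...   | k , j∈k = begin
  kent i           ≤⟨ kent-mono 1≤i (≤-pred i<1+j) ⟩
  kent j           ≤⟨ m≤m+n _ _ ⟩
  kent j + cap k   ≡⟨ kent-step j∈k ⟨
  kent (suc j)     ∎
  where open ≤-Reasoning

cap≤kent : ∀ {k ℓ} → Slot k ℓ → cap (suc k) ≤ kent ℓ
cap≤kent (at₁ k) = ≤-reflexive (sym (kent-ix₁ k))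
cap≤kent (at₂ k) = ≤-trans (m≤m+n _ _) (≤-reflexive (sym (kent-ix₂ k)))

top-room : ∀ {k ℓ} → Slot k ℓ → kent ℓ + cap k ≤ cap (suc (suc k))
top-room (at₁ k) = ≤-trans (≤-reflexive (cong (_+ cap k) (kent-ix₁ k)))
                           (+-monoʳ-≤ (cap (suc k)) (m≤m+n (cap k) (cap k + 0)))
top-room (at₂ k) = ≤-reflexive (trans (cong (_+ cap k) (kent-ix₂ k)) (twice-right (cap (suc k)) (cap k)))

Gap-trans : ∀ {x y z} → Gap x y → Gap y z → Gap x z
Gap-trans (x<y , gxy) (y<z , gyz) = <-trans x<y y<z , ≤-trans gxy (≤-trans (m≤n+m _ 2) gyz)

-- Bins two apart force the gap condition (indices are ordered as their bins).
gap-of-bins : ∀ {x y} → 2 + bin x ≤ bin y → Gap x y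
gap-of-bins {x} {y} g with x <? y
... | yes x<y = x<y , g
... | no x≮y = contradiction (⌈n/2⌉-mono (≮⇒≥ x≮y)) (<⇒≱ (≤-trans (n≤1+n _) g))

bin-below-gap : ∀ {k x y} → Slot k y → Gap x y → bin x < k
bin-below-gap {k} {x} y∈k (_ , g) = ≤-pred (subst (2 + bin x ≤_) (bin-slot y∈k) g)

data LastView : List ℕ → Set where
  empty : LastView []
  snoc  : ∀ xs y → Linked Gap xs → All (λ x → Gap x y) xs → LastView (xs ++ [ y ])

lastView : ∀ {ls} → Linked Gap ls → LastView ls
lastView [] = empty
lastView {_ ∷ _} lk = prepend (lastView (Linked.tail lk)) lk
  where
  prepend : ∀ {x ys} → LastView ys → Linked Gap (x ∷ ys) → LastView (x ∷ ys)
  prepend {x} empty [-] = snoc [] x [] []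
  prepend {x} (snoc [] z _ _) (g ∷ _) = snoc (x ∷ []) z [-] (g ∷ [])
  prepend {x} (snoc (w ∷ ws) z lws (gw ∷ gs)) (g ∷ _) =
    snoc (x ∷ w ∷ ws) z (g ∷ lws) (Gap-trans g gw ∷ gw ∷ gs)

snoc-linked : ∀ {xs y} → Linked Gap xs → All (λ x → Gap x y) xs → Linked Gap (xs ++ [ y ])
snoc-linked [] [] = [-]
snoc-linked [-] (g ∷ []) = g ∷ [-]
snoc-linked (g ∷ lk) (_ ∷ gs) = g ∷ snoc-linked lk gs

value : List ℕ → ℕ
value ls = sum (map kent ls)

value-snoc : ∀ xs y → value (xs ++ [ y ]) ≡ value xs + kent y
value-snoc xs y = begin
  sum (map kent (xs ++ [ y ]))      ≡⟨ cong sum (map-++ kent xs [ y ]) ⟩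
  sum (map kent xs ++ [ kent y ])   ≡⟨ sum-++ (map kent xs) [ kent y ] ⟩
  value xs + (kent y + 0)           ≡⟨ cong (value xs +_) (+-identityʳ (kent y)) ⟩
  value xs + kent y                 ∎
  where open ≡-Reasoning

length-snoc : ∀ (xs : List ℕ) y → length (xs ++ [ y ]) ≡ suc (length xs)
length-snoc xs y = trans (length-++ xs) (+-comm (length xs) 1)

summand≤value : ∀ ls → All (λ ℓ → kent ℓ ≤ value ls) ls
summand≤value [] = []
summand≤value (x ∷ ls) =
  m≤m+n (kent x) (value ls) ∷ All.map (λ p → ≤-trans p (m≤n+m _ (kent x))) (summand≤value ls)

Below : ℕ → ℕ → Set
Below j ℓ = (1 ≤ ℓ) × (bin ℓ < j)

Legal : ℕ → List ℕ → Set
Legal j ls = Linked Gap ls × All (Below j) ls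

init-below : ∀ {k y xs} → Slot k y → All (1 ≤_) xs → All (λ x → Gap x y) xs → All (Below k) xs
init-below y∈k pos gaps = All.zipWith (λ (1≤x , g) → 1≤x , bin-below-gap y∈k g) (pos , gaps)

widen : ∀ {i j ls} → i ≤ j → Legal i ls → Legal j ls
widen i≤j (lk , al) = lk , All.map (λ (1≤ℓ , b<i) → 1≤ℓ , ≤-trans b<i i≤j) al

extend : ∀ {j xs y} → Slot j y → Legal j xs → Legal (suc (suc j)) (xs ++ [ y ])
extend {j} {xs} {y} y∈j (lk , al) =
  snoc-linked lk (All.map gap al) ,
  All.++⁺ (proj₂ (widen (m≤n+m j 2) (lk , al)))
          ((slot-pos y∈j , subst (_< suc (suc j)) (sym (bin-slot y∈j)) ≤-refl) ∷ [])
  where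
  gap : ∀ {x} → Below j x → Gap x y
  gap {x} (_ , b<j) = gap-of-bins (subst (2 + bin x ≤_) (sym (bin-slot y∈j)) (s≤s b<j))

-- The structure behind cap (j + 2) = cap (j + 1) + cap j + cap j: a legal
-- decomposition with bins < j + 2 either avoids bin j + 1, or it is a
-- decomposition with bins < j followed by one of the two indices of bin j + 1.
data TopView (j : ℕ) : List ℕ → Set where
  below : ∀ {ls} → Legal (suc j) ls → TopView j ls
  ends  : ∀ {xs y} → Slot j y → Legal j xs → TopView j (xs ++ [ y ])

topView : ∀ {j ls} → Legal (suc (suc j)) ls → TopView j ls
topView {j} (lk , al) with lastView lk
... | empty = below ([] , [])
... | snoc xs y lxs gaps with All.++⁻ xs al
...   | alxs , (1≤y , by<) ∷ [] with slot 1≤y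
...     | k , y∈k = by-bin (m≤n⇒m<n∨m≡n (≤-pred (≤-pred (subst (_< _) (bin-slot y∈k) by<))))
  where
  xs-below : All (Below k) xs
  xs-below = init-below y∈k (All.map proj₁ alxs) gaps
  by-bin : k < j ⊎ k ≡ j → TopView j (xs ++ [ y ])
  by-bin (inj₁ k<j) =
    below (lk , All.++⁺ (proj₂ (widen (≤-trans (n≤1+n k) (s≤s (<⇒≤ k<j))) (lxs , xs-below)))
                        ((1≤y , subst (_< suc j) (sym (bin-slot y∈k)) (s≤s k<j)) ∷ []))
  by-bin (inj₂ refl) = ends y∈k (lxs , xs-below)

-- summands j m: the number of summands of the decomposition of m < cap j with
-- bins < j, computed greedily: bin j - 1 contributes a summand exactly when
-- m ≥ cap (j - 1), namely its larger term when m ≥ cap (j - 1) + cap (j - 2).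
summands : ℕ → ℕ → ℕ
summands zero m = 0
summands (suc zero) m = 0
summands (suc (suc j)) m =
  if m <ᵇ cap (suc j) then summands (suc j) m
  else suc (summands j (m ∸ top))
  where
  top : ℕ
  top = if m <ᵇ cap (suc j) + cap j then cap (suc j) else cap (suc j) + cap j

summands-low : ∀ j m → m < cap (suc j) → summands (suc (suc j)) m ≡ summands (suc j) m
summands-low j m m< with m <ᵇ cap (suc j) | <ᵇ-reflects-< m (cap (suc j))
... | true  | _ = refl
... | false | ofⁿ m≮ = contradiction m< m≮

summands-top : ∀ {j y} → Slot j y → ∀ v → v < cap j →
  summands (suc (suc j)) (v + kent y) ≡ suc (summands j v)
summands-top (at₁ j) v v< rewrite kent-ix₁ j
  with v + cap (suc j) <ᵇ cap (suc j) | <ᵇ-reflects-< (v + cap (suc j)) (cap (suc j))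
     | v + cap (suc j) <ᵇ cap (suc j) + cap j | <ᵇ-reflects-< (v + cap (suc j)) (cap (suc j) + cap j)
... | true  | ofʸ v+c< | _ | _ = contradiction v+c< (≤⇒≯ (m≤n+m _ v))
... | false | _ | true  | _ = cong (suc ∘ summands j) (m+n∸n≡m v (cap (suc j)))
... | false | _ | false | ofⁿ v+c≮ =
  contradiction (subst (v + cap (suc j) <_) (+-comm (cap j) (cap (suc j))) (+-monoˡ-< (cap (suc j)) v<)) v+c≮
summands-top (at₂ j) v v< rewrite kent-ix₂ j
  with v + (cap (suc j) + cap j) <ᵇ cap (suc j) | <ᵇ-reflects-< (v + (cap (suc j) + cap j)) (cap (suc j))
     | v + (cap (suc j) + cap j) <ᵇ cap (suc j) + cap j | <ᵇ-reflects-< (v + (cap (suc j) + cap j)) (cap (suc j) + cap j)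
... | true  | ofʸ v+c< | _ | _ = contradiction v+c< (≤⇒≯ (≤-trans (m≤m+n _ _) (m≤n+m _ v)))
... | false | _ | true  | ofʸ v+c< = contradiction v+c< (≤⇒≯ (m≤n+m _ v))
... | false | _ | false | _ = cong (suc ∘ summands j) (m+n∸n≡m v (cap (suc j) + cap j))

nothing-below-1 : ∀ {ℓ} → ¬ Below 1 ℓ
nothing-below-1 (1≤ℓ , b<1) = <⇒≱ b<1 (⌈n/2⌉-mono 1≤ℓ)

ValueBound : ℕ → Set
ValueBound j = ∀ {ls} → Legal j ls → value ls < cap j

value-bound-step : ∀ {j} → ValueBound (suc j) → ValueBound j → ValueBound (suc (suc j))
value-bound-step {j} ih₁ ih₀ leg with topView leg
... | below leg′ = <-≤-trans (ih₁ leg′) (m≤m+n _ _)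
... | ends {xs} {y} y∈j leg′ = begin-strict
  value (xs ++ [ y ])  ≡⟨ value-snoc xs y ⟩
  value xs + kent y    <⟨ +-monoˡ-< (kent y) (ih₀ leg′) ⟩
  cap j + kent y       ≡⟨ +-comm (cap j) (kent y) ⟩
  kent y + cap j       ≤⟨ top-room y∈j ⟩
  cap (suc (suc j))    ∎
  where open ≤-Reasoning

value-bound : ∀ j → ValueBound j
value-bound zero (_ , []) = ≤-refl
value-bound zero (_ , (_ , ()) ∷ _)
value-bound (suc zero) (_ , []) = ≤-refl
value-bound (suc zero) (_ , ℓ<1 ∷ _) = contradiction ℓ<1 nothing-below-1
value-bound (suc (suc j)) = value-bound-step (value-bound (suc j)) (value-bound j)

CountCorrect : ℕ → Set
CountCorrect j = ∀ {ls} → Legal j ls → length ls ≡ summands j (value ls)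

summands-correct-step : ∀ {j} → CountCorrect (suc j) → CountCorrect j → CountCorrect (suc (suc j))
summands-correct-step {j} ih₁ ih₀ leg with topView leg
... | below leg′ = trans (ih₁ leg′) (sym (summands-low j _ (value-bound (suc j) leg′)))
... | ends {xs} {y} y∈j leg′ = begin
  length (xs ++ [ y ])                          ≡⟨ length-snoc xs y ⟩
  suc (length xs)                               ≡⟨ cong suc (ih₀ leg′) ⟩
  suc (summands j (value xs))                   ≡⟨ summands-top y∈j (value xs) (value-bound j leg′) ⟨
  summands (suc (suc j)) (value xs + kent y)    ≡⟨ cong (summands (suc (suc j))) (value-snoc xs y) ⟨
  summands (suc (suc j)) (value (xs ++ [ y ]))  ∎
  where open ≡-Reasoning

summands-correct : ∀ j → CountCorrect j
summands-correct zero (_ , []) = refl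
summands-correct zero (_ , (_ , ()) ∷ _)
summands-correct (suc zero) (_ , []) = refl
summands-correct (suc zero) (_ , ℓ<1 ∷ _) = contradiction ℓ<1 nothing-below-1
summands-correct (suc (suc j)) = summands-correct-step (summands-correct (suc j)) (summands-correct j)

Decomposition : ℕ → ℕ → Set
Decomposition j m = Σ (List ℕ) λ ls → Legal j ls × value ls ≡ m

Decomposable : ℕ → Set
Decomposable j = ∀ m → m < cap j → Decomposition j m

on-top : ∀ {j y m} → Slot j y → kent y ≤ m → m < kent y + cap j →
  Decomposable j → Decomposition (suc (suc j)) m
on-top {j} {y} {m} y∈j y≤m m< decompose-j =
  let (xs , leg , v) = decompose-j (m ∸ kent y) remainder<
  in xs ++ [ y ] , extend y∈j leg , trans (value-snoc xs y) (trans (cong (_+ kent y) v) (m∸n+n≡m y≤m))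
  where
  remainder< : m ∸ kent y < cap j
  remainder< = subst (m ∸ kent y <_) (m+n∸m≡n (kent y) (cap j)) (∸-monoˡ-< m< y≤m)

decompose-step : ∀ {j} → Decomposable (suc j) → Decomposable j → Decomposable (suc (suc j))
decompose-step {j} ih₁ ih₀ m m< with m <? cap (suc j)
... | yes m<c = let (ls , leg , v) = ih₁ m m<c in ls , widen (n≤1+n _) leg , v
... | no m≮c with m <? kent (ix₂ j)
...   | yes m<k₂ =
  on-top (at₁ j) (subst (_≤ m) (sym (kent-ix₁ j)) (≮⇒≥ m≮c)) (subst (m <_) (kent-step (at₁ j)) m<k₂) ih₀
...   | no m≮k₂ =
  on-top (at₂ j) (≮⇒≥ m≮k₂) (subst (m <_) (trans (sym (kent-ix₁ (suc j))) (kent-step (at₂ j))) m<) ih₀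

decompose : ∀ j → Decomposable j
decompose zero zero _ = [] , ([] , []) , refl
decompose zero (suc m) (s≤s ())
decompose (suc zero) zero _ = [] , ([] , []) , refl
decompose (suc zero) (suc m) (s≤s ())
decompose (suc (suc j)) = decompose-step (decompose (suc j)) (decompose j)

Idx : ℕ → ℕ → Set
Idx N ℓ = (1 ≤ ℓ) × (ℓ ≤ N)

-- A legal decomposition using kent₁, …, kent_N stays below kent (N + 1):
-- below its top summand y (in bin k + 1) lies a value < cap k, and
-- kent y + cap k = kent (y + 1) ≤ kent (N + 1).
below-next : ∀ N {ls} → Linked Gap ls → All (Idx N) ls → value ls < kent (suc N)
below-next N lk al with lastView lk
... | empty = kent-pos {suc N} (s≤s z≤n)
... | snoc xs y lxs gaps with All.++⁻ xs al
...   | alxs , (1≤y , y≤N) ∷ [] with slot 1≤y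
...     | k , y∈k = begin-strict
  value (xs ++ [ y ])  ≡⟨ value-snoc xs y ⟩
  value xs + kent y    <⟨ +-monoˡ-< (kent y) (value-bound k (lxs , xs-below)) ⟩
  cap k + kent y       ≡⟨ trans (+-comm (cap k) (kent y)) (sym (kent-step y∈k)) ⟩
  kent (suc y)         ≤⟨ kent-mono (s≤s z≤n) (s≤s y≤N) ⟩
  kent (suc N)         ∎
  where
  open ≤-Reasoning
  xs-below : All (Below k) xs
  xs-below = init-below y∈k (All.map proj₁ alxs) gaps

index-bound : ∀ {N ℓ} → 1 ≤ ℓ → kent ℓ < kent (suc N) → ℓ ≤ N
index-bound {N} {ℓ} 1≤ℓ k< with ℓ ≤? N
... | yes ℓ≤N = ℓ≤N
... | no ℓ≰N = contradiction (kent-mono (s≤s z≤n) (≰⇒> ℓ≰N)) (<⇒≱ k<)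

kent-missing : ∀ N → ¬ HasLegalDecomp kent N (kent (suc N))
kent-missing N (ls , al , lk , v) = <⇒≢ (below-next N lk al) v

kent-below : ∀ N x → x < kent (suc N) → HasLegalDecomp kent N x
kent-below N x x< with slot {suc N} (s≤s z≤n)
... | k , N+1∈k with decompose (suc (suc k)) x (<-≤-trans x< (≤-trans (m≤m+n _ _) (top-room N+1∈k)))
...   | ls , (lk , al) , v = ls , All.zipWith index≤N (al , summand≤value ls) , lk , v
  where
  index≤N : ∀ {ℓ} → Below (suc (suc k)) ℓ × kent ℓ ≤ value ls → Idx N ℓ
  index≤N ((1≤ℓ , _) , kℓ≤) = 1≤ℓ , index-bound 1≤ℓ (≤-<-trans kℓ≤ (subst (_< kent (suc N)) (sym v) x<))

Agree : (ℕ → ℕ) → ℕ → Set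
Agree a N = ∀ ℓ → 1 ≤ ℓ → ℓ ≤ N → a ℓ ≡ kent ℓ

sum-agree : ∀ {a N ls} → Agree a N → All (Idx N) ls → sum (map a ls) ≡ value ls
sum-agree agr al = cong sum (map-cong-local (All.map (λ (1≤ℓ , ℓ≤N) → agr _ 1≤ℓ ℓ≤N) al))

to-kent : ∀ {a N m} → Agree a N → HasLegalDecomp a N m → HasLegalDecomp kent N m
to-kent agr (ls , al , lk , v) = ls , al , lk , trans (sym (sum-agree agr al)) v

from-kent : ∀ {a N m} → Agree a N → HasLegalDecomp kent N m → HasLegalDecomp a N m
from-kent agr (ls , al , lk , v) = ls , al , lk , trans (sum-agree agr al) v

agree-next : ∀ {a} → IsKentucky2 a → ∀ N → Agree a N → a (suc N) ≡ kent (suc N)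
agree-next (a₁ , _) zero _ = a₁
agree-next {a} (_ , next) (suc N) agr with next (suc N) (s≤s z≤n)
... | _ , a-missing , a-below with <-cmp (a (suc (suc N))) (kent (suc (suc N)))
...   | tri< a<k _ _ = contradiction (from-kent agr (kent-below (suc N) _ a<k)) a-missing
...   | tri≈ _ a≡k _ = a≡k
...   | tri> _ _ k<a =
  contradiction (to-kent agr (a-below _ (kent-pos {suc (suc N)} (s≤s z≤n)) k<a)) (kent-missing (suc N))

agree : ∀ {a} → IsKentucky2 a → ∀ N → Agree a N
agree K zero ℓ 1≤ℓ ℓ≤0 = contradiction (≤-trans 1≤ℓ ℓ≤0) λ ()
agree K (suc N) ℓ 1≤ℓ ℓ≤N+1 with m≤n⇒m<n∨m≡n ℓ≤N+1
... | inj₁ ℓ<N+1 = agree K N ℓ 1≤ℓ (≤-pred ℓ<N+1)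
... | inj₂ refl = agree-next K N (agree K N)

sumBelow : (ℕ → ℕ) → ℕ → ℕ
sumBelow f zero = 0
sumBelow f (suc n) = f 0 + sumBelow (f ∘ suc) n

sum-upTo : ∀ (f : ℕ → ℕ) n → sum (map f (upTo n)) ≡ sumBelow f n
sum-upTo f n = go f (λ i → i) n
  where
  go : ∀ (f g : ℕ → ℕ) n → sum (map f (applyUpTo g n)) ≡ sumBelow (f ∘ g) n
  go f g zero = refl
  go f g (suc n) = cong (f (g 0) +_) (go f (g ∘ suc) n)

sumBelow-cong : ∀ {f g : ℕ → ℕ} n → (∀ i → i < n → f i ≡ g i) → sumBelow f n ≡ sumBelow g n
sumBelow-cong zero _ = refl
sumBelow-cong (suc n) f≡g = cong₂ _+_ (f≡g 0 (s≤s z≤n)) (sumBelow-cong n (λ i i< → f≡g (suc i) (s≤s i<)))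

sumBelow-split : ∀ (f : ℕ → ℕ) a c → sumBelow f (a + c) ≡ sumBelow f a + sumBelow (λ i → f (i + a)) c
sumBelow-split f zero c = sumBelow-cong c (λ i _ → cong f (sym (+-identityʳ i)))
sumBelow-split f (suc a) c = begin
  f 0 + sumBelow (f ∘ suc) (a + c)
    ≡⟨ cong (f 0 +_) (sumBelow-split (f ∘ suc) a c) ⟩
  f 0 + (sumBelow (f ∘ suc) a + sumBelow (λ i → f (suc (i + a))) c)
    ≡⟨ +-assoc (f 0) _ _ ⟨
  f 0 + sumBelow (f ∘ suc) a + sumBelow (λ i → f (suc (i + a))) c
    ≡⟨ cong (f 0 + sumBelow (f ∘ suc) a +_) (sumBelow-cong c (λ i _ → cong f (sym (+-suc i a)))) ⟩
  f 0 + sumBelow (f ∘ suc) a + sumBelow (λ i → f (i + suc a)) c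
    ∎
  where open ≡-Reasoning

sumBelow-suc : ∀ (f : ℕ → ℕ) n → sumBelow (suc ∘ f) n ≡ n + sumBelow f n
sumBelow-suc f zero = refl
sumBelow-suc f (suc n) = cong suc (begin
  f 0 + sumBelow (suc ∘ f ∘ suc) n  ≡⟨ cong (f 0 +_) (sumBelow-suc (f ∘ suc) n) ⟩
  f 0 + (n + sumBelow (f ∘ suc) n)  ≡⟨ swap (f 0) n _ ⟩
  n + (f 0 + sumBelow (f ∘ suc) n)  ∎)
  where
  open ≡-Reasoning
  swap : ∀ x y z → x + (y + z) ≡ y + (x + z)
  swap = solve-∀

total : ℕ → ℕ
total j = sumBelow (summands j) (cap j)

-- Above the top index y of bin j + 1 every value carries one extra summand.
top-block : ∀ {j y} → Slot j y → sumBelow (λ i → summands (suc (suc j)) (i + kent y)) (cap j) ≡ cap j + total j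
top-block {j} y∈j = trans (sumBelow-cong (cap j) (summands-top y∈j)) (sumBelow-suc (summands j) (cap j))

-- Splitting [0, cap (j + 2)) at cap (j + 1) = kent (ix₁ j) and kent (ix₂ j):
total-step : ∀ j → total (suc (suc j)) ≡ total (suc j) + 2 * total j + 2 * cap j
total-step j = begin
  sumBelow f (c₁ + 2 * c₀)
    ≡⟨ cong (sumBelow f) (cong (c₁ +_) (cong (c₀ +_) (+-identityʳ c₀))) ⟩
  sumBelow f (c₁ + (c₀ + c₀))
    ≡⟨ sumBelow-split f c₁ (c₀ + c₀) ⟩
  sumBelow f c₁ + sumBelow (λ i → f (i + c₁)) (c₀ + c₀)
    ≡⟨ cong (sumBelow f c₁ +_) (sumBelow-split (λ i → f (i + c₁)) c₀ c₀) ⟩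
  sumBelow f c₁ + (sumBelow (λ i → f (i + c₁)) c₀ + sumBelow (λ i → f (i + c₀ + c₁)) c₀)
    ≡⟨ cong₂ _+_ low (cong₂ _+_ first second) ⟩
  total (suc j) + ((c₀ + total j) + (c₀ + total j))
    ≡⟨ rearrange (total (suc j)) (total j) c₀ ⟩
  total (suc j) + 2 * total j + 2 * c₀
    ∎
  where
  open ≡-Reasoning
  f : ℕ → ℕ
  f = summands (suc (suc j))
  c₁ c₀ : ℕ
  c₁ = cap (suc j)
  c₀ = cap j
  rearrange : ∀ t₁ t₀ c → t₁ + ((c + t₀) + (c + t₀)) ≡ t₁ + 2 * t₀ + 2 * c
  rearrange = solve-∀
  low : sumBelow f c₁ ≡ total (suc j)
  low = sumBelow-cong c₁ (summands-low j)
  first : sumBelow (λ i → f (i + c₁)) c₀ ≡ c₀ + total j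
  first = trans (sumBelow-cong c₀ (λ i _ → cong (λ t → f (i + t)) (sym (kent-ix₁ j)))) (top-block (at₁ j))
  second : sumBelow (λ i → f (i + c₀ + c₁)) c₀ ≡ c₀ + total j
  second = trans (sumBelow-cong c₀ (λ i _ → cong f (shift i)))  (top-block (at₂ j))
    where
    shift : ∀ i → i + c₀ + c₁ ≡ i + kent (ix₂ j)
    shift i = trans (+-assoc i c₀ c₁) (cong (i +_) (trans (+-comm c₀ c₁) (sym (kent-ix₂ j))))

isEven isOdd : ℕ → ℕ
isEven zero = 1
isEven (suc n) = isOdd n
isOdd zero = 0
isOdd (suc n) = isEven n

parity : ∀ n → (isEven n ≡ 1 × isOdd n ≡ 0) ⊎ (isEven n ≡ 0 × isOdd n ≡ 1)
parity zero = inj₁ (refl , refl)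
parity (suc n) with parity n
... | inj₁ (e , o) = inj₂ (o , e)
... | inj₂ (e , o) = inj₁ (o , e)

-- cap (n + 1) = 2 cap n + (-1)ⁿ⁺¹, written without signs.
cap-parity : ∀ n → cap (suc n) + isEven n ≡ 2 * cap n + isOdd n
cap-parity zero = refl
cap-parity (suc n) = begin
  cap (suc n) + 2 * cap n + isOdd n    ≡⟨ +-assoc (cap (suc n)) _ _ ⟩
  cap (suc n) + (2 * cap n + isOdd n)  ≡⟨ cong (cap (suc n) +_) (cap-parity n) ⟨
  cap (suc n) + (cap (suc n) + isEven n) ≡⟨ double (cap (suc n)) (isEven n) ⟩
  2 * cap (suc n) + isEven n           ∎
  where
  open ≡-Reasoning
  double : ∀ x e → x + (x + e) ≡ 2 * x + e
  double = solve-∀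

-- Closed form of the total: 9 · total (n + 1) = (3n + 2) · cap (n + 1) + (-1)ⁿ⁺¹ (n + 2).
TotalClosed : ℕ → Set
TotalClosed n = 9 * total (suc n) + (n + 2) * isEven n ≡ (3 * n + 2) * cap (suc n) + (n + 2) * isOdd n

-- The induction step: add the hypotheses for n + 1 and n and the parity
-- recurrence (with weights 1, 2, 3) to both sides, then cancel them.
total-closed-step : ∀ n → TotalClosed (suc n) → TotalClosed n → TotalClosed (suc (suc n))
total-closed-step n ih₁ ih₀ = +-cancelʳ-≡ _ _ _ (begin
  9 * total (3 + n) + (2 + n + 2) * e + (R₁ + 2 * R₀ + 3 * Lq)
    ≡⟨ cong (λ t → 9 * t + (2 + n + 2) * e + (R₁ + 2 * R₀ + 3 * Lq)) (total-step (suc n)) ⟩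
  9 * (t₂ + 2 * t₁ + 2 * c₁) + (2 + n + 2) * e + (R₁ + 2 * R₀ + 3 * Lq)
    ≡⟨ combination n t₂ t₁ c₂ c₁ e o ⟩
  (3 * (2 + n) + 2) * (c₂ + 2 * c₁) + (2 + n + 2) * o + (L₁ + 2 * L₀ + 3 * Rq)
    ≡⟨ cong ((3 * (2 + n) + 2) * (c₂ + 2 * c₁) + (2 + n + 2) * o +_) hypotheses ⟩
  (3 * (2 + n) + 2) * (c₂ + 2 * c₁) + (2 + n + 2) * o + (R₁ + 2 * R₀ + 3 * Lq)
    ∎)
  where
  open ≡-Reasoning
  t₂ t₁ c₂ c₁ e o : ℕ
  t₂ = total (2 + n)
  t₁ = total (1 + n)
  c₂ = cap (2 + n)
  c₁ = cap (1 + n)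
  e = isEven n
  o = isOdd n
  L₁ R₁ L₀ R₀ Lq Rq : ℕ
  L₁ = 9 * t₂ + (1 + n + 2) * o
  R₁ = (3 * (1 + n) + 2) * c₂ + (1 + n + 2) * e
  L₀ = 9 * t₁ + (n + 2) * e
  R₀ = (3 * n + 2) * c₁ + (n + 2) * o
  Lq = c₂ + o
  Rq = 2 * c₁ + e
  hypotheses : L₁ + 2 * L₀ + 3 * Rq ≡ R₁ + 2 * R₀ + 3 * Lq
  hypotheses = cong₂ _+_ (cong₂ (λ u v → u + 2 * v) ih₁ ih₀) (cong (3 *_) (sym (cap-parity (suc n))))
  combination : ∀ n t₂ t₁ c₂ c₁ e o →
    9 * (t₂ + 2 * t₁ + 2 * c₁) + (2 + n + 2) * e
      + (((3 * (1 + n) + 2) * c₂ + (1 + n + 2) * e) + 2 * ((3 * n + 2) * c₁ + (n + 2) * o) + 3 * (c₂ + o))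
    ≡ (3 * (2 + n) + 2) * (c₂ + 2 * c₁) + (2 + n + 2) * o
      + ((9 * t₂ + (1 + n + 2) * o) + 2 * (9 * t₁ + (n + 2) * e) + 3 * (2 * c₁ + e))
  combination = solve-∀

total-closed : ∀ n → TotalClosed n
total-closed zero = refl
total-closed (suc zero) = refl
total-closed (suc (suc n)) = total-closed-step n (total-closed (suc n)) (total-closed n)

-- The final rational estimate, computed on unnormalised fractions; the integer
-- notation is kept local to this module.
module DeviationEstimate where
  open import Data.Integer as ℤ using (ℤ; +_; +≤+)
  import Data.Integer.Properties as ℤP
  import Data.Integer.Tactic.RingSolver as ℤ-Solver
  import Data.Rational as ℚ
  open import Data.Rational using (toℚᵘ)
  open import Data.Rational.Properties using (toℚᵘ-cancel-≤; toℚᵘ-homo-∣-∣; toℚᵘ-homo-+; toℚᵘ-homo‿-; toℚᵘ-fromℚᵘ)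
  import Data.Rational.Unnormalised as ℚᵘ
  import Data.Rational.Unnormalised.Properties as ℚᵘP

  Close : ℕ → ℕ → ℕ → Set
  Close T n A = (9 * T + (n + 2) ≡ (3 * n + 2) * A) ⊎ (9 * T ≡ (3 * n + 2) * A + (n + 2))

  -- 27 · (T / A − (n / 3 + 2 / 9)) · A, the numerator of the deviation of the
  -- mean T / A from n / 3 + 2 / 9 over the common denominator 27 A.
  deviation : ℕ → ℕ → ℕ → ℤ
  deviation T n A = + T ℤ.* + 27 ℤ.+ (ℤ.- (+ n ℤ.* + 9 ℤ.+ + 2 ℤ.* + 3)) ℤ.* + A

  ∣deviation∣ : ∀ T n A → Close T n A → ℤ.∣ deviation T n A ∣ ≡ 3 * (n + 2)
  ∣deviation∣ T n A close = begin
    ℤ.∣ deviation T n A ∣         ≡⟨ cong ℤ.∣_∣ (factor (+ T) (+ n) (+ A)) ⟩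
    ℤ.∣ + 3 ℤ.* (u ℤ.- w) ∣        ≡⟨ ℤP.∣i*j∣≡∣i∣*∣j∣ (+ 3) (u ℤ.- w) ⟩
    3 * ℤ.∣ u ℤ.- w ∣              ≡⟨ cong (3 *_) (difference close) ⟩
    3 * (n + 2)                    ∎
    where
    open ≡-Reasoning
    u w : ℤ
    u = + 9 ℤ.* + T
    w = (+ 3 ℤ.* + n ℤ.+ + 2) ℤ.* + A
    factor : ∀ T n A → T ℤ.* + 27 ℤ.+ (ℤ.- (n ℤ.* + 9 ℤ.+ + 2 ℤ.* + 3)) ℤ.* A
                     ≡ + 3 ℤ.* (+ 9 ℤ.* T ℤ.- (+ 3 ℤ.* n ℤ.+ + 2) ℤ.* A)
    factor = ℤ-Solver.solve-∀
    cast-u : + (9 * T) ≡ u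
    cast-u = ℤP.pos-* 9 T
    cast-w : + ((3 * n + 2) * A) ≡ w
    cast-w = trans (ℤP.pos-* (3 * n + 2) A) (cong (ℤ._* + A) (cong (ℤ._+ + 2) (ℤP.pos-* 3 n)))
    k : ℤ
    k = + (n + 2)
    difference : Close T n A → ℤ.∣ u ℤ.- w ∣ ≡ n + 2
    difference (inj₁ short) = begin
      ℤ.∣ u ℤ.- w ∣              ≡⟨ cong (λ v → ℤ.∣ u ℤ.- v ∣) w≡u+k ⟩
      ℤ.∣ u ℤ.- (u ℤ.+ k) ∣      ≡⟨ cong ℤ.∣_∣ (cancel u k) ⟩
      ℤ.∣ ℤ.- k ∣                ≡⟨ ℤP.∣-i∣≡∣i∣ k ⟩
      n + 2                      ∎
      where
      w≡u+k : w ≡ u ℤ.+ k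
      w≡u+k = trans (sym cast-w) (trans (cong +_ (sym short)) (cong (ℤ._+ k) cast-u))
      cancel : ∀ u k → u ℤ.- (u ℤ.+ k) ≡ ℤ.- k
      cancel = ℤ-Solver.solve-∀
    difference (inj₂ excess) = cong ℤ.∣_∣ (trans (cong (ℤ._- w) u≡w+k) (cancel w k))
      where
      u≡w+k : u ≡ w ℤ.+ k
      u≡w+k = trans (sym cast-u) (trans (cong +_ excess) (cong (ℤ._+ k) cast-w))
      cancel : ∀ w k → (w ℤ.+ k) ℤ.- w ≡ k
      cancel = ℤ-Solver.solve-∀

  -- Then the mean T / A deviates from n / 3 + 2 / 9 by exactly (n + 2) / 9A,
  -- which is at most n / P as soon as (n + 2) P ≤ 9nA.
  mean-estimate : ∀ T n A P → 1 ≤ A → 1 ≤ P → Close T n A → (n + 2) * P ≤ 9 * n * A →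
    ∣ (T // A) - ((n // 3) +ℚ (2 // 9)) ∣ ≤ℚ n // P
  mean-estimate T n (suc A') (suc P') _ _ close room =
    toℚᵘ-cancel-≤ (ℚᵘP.≤-respˡ-≃ (ℚᵘP.≃-sym unnormalised) (ℚᵘP.≤-respʳ-≃ (ℚᵘP.≃-sym (as-fraction n P')) in-ℚᵘ))
    where
    A P : ℕ
    A = suc A'
    P = suc P'
    as-fraction : ∀ m d → toℚᵘ (m // suc d) ℚᵘ.≃ ℚᵘ.mkℚᵘ (+ m) d
    as-fraction m d = toℚᵘ-fromℚᵘ (ℚᵘ.mkℚᵘ (+ m) d)
    -- computed on unnormalised fractions, the left-hand side is
    -- ∣deviation T n A∣ / 27A (this holds by definitional unfolding)
    unnormalised : toℚᵘ ∣ (T // A) - ((n // 3) +ℚ (2 // 9)) ∣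
      ℚᵘ.≃ ℚᵘ.∣ ℚᵘ.mkℚᵘ (+ T) A' ℚᵘ.- (ℚᵘ.mkℚᵘ (+ n) 2 ℚᵘ.+ ℚᵘ.mkℚᵘ (+ 2) 8) ∣
    unnormalised =
      ℚᵘP.≃-trans (toℚᵘ-homo-∣-∣ (T // A - target)) (ℚᵘP.∣-∣-cong (ℚᵘP.≃-trans (toℚᵘ-homo-+ (T // A) (ℚ.- target))
        (ℚᵘP.+-cong (as-fraction T A') (ℚᵘP.≃-trans (toℚᵘ-homo‿- target)
          (ℚᵘP.-‿cong (ℚᵘP.≃-trans (toℚᵘ-homo-+ (n // 3) (2 // 9)) (ℚᵘP.+-cong (as-fraction n 2) (as-fraction 2 8))))))))
      where
      target : ℚ
      target = (n // 3) +ℚ (2 // 9)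
    in-ℚᵘ : ℚᵘ.mkℚᵘ (+ ℤ.∣ deviation T n A ∣) (26 + A' * 27) ℚᵘ.≤ ℚᵘ.mkℚᵘ (+ n) P'
    in-ℚᵘ = ℚᵘ.*≤* (subst₂ ℤ._≤_ (ℤP.pos-* (ℤ.∣ deviation T n A ∣) P) (ℤP.pos-* n (A * 27)) (+≤+ cross))
      where
      cross : ℤ.∣ deviation T n A ∣ * P ≤ n * (A * 27)
      cross = subst (λ d → d * P ≤ n * (A * 27)) (sym (∣deviation∣ T n A close))
        (≤-trans (≤-reflexive (assoc n P)) (≤-trans (*-monoʳ-≤ 3 room) (≤-reflexive (assoc′ n A))))
        where
        assoc : ∀ n P → 3 * (n + 2) * P ≡ 3 * ((n + 2) * P)
        assoc = solve-∀
        assoc′ : ∀ n A → 3 * (9 * n * A) ≡ n * (A * 27)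
        assoc′ = solve-∀

open DeviationEstimate using (Close; mean-estimate)

bin-bound : ∀ {ℓ j} → 1 ≤ ℓ → kent ℓ < cap j → bin ℓ < j
bin-bound {ℓ} {j} 1≤ℓ kℓ< with slot 1≤ℓ
... | k , ℓ∈k rewrite bin-slot ℓ∈k with suc k <? j
...   | yes k+1<j = k+1<j
...   | no k+1≮j = contradiction (≤-trans (cap-mono (≮⇒≥ k+1≮j)) (cap≤kent ℓ∈k)) (<⇒≱ kℓ<)

count-is-summands : ∀ {a} → IsKentucky2 a → ∀ {N m ls j} → LegalDecomp a N m ls → m < cap j →
  length ls ≡ summands j m
count-is-summands K {N} {m} {ls} {j} (al , lk , v) m< =
  trans (summands-correct j (lk , All.zipWith in-bins (al , summand≤value ls))) (cong (summands j) value≡m)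
  where
  value≡m : value ls ≡ m
  value≡m = trans (sym (sum-agree (agree K N) al)) v
  in-bins : ∀ {ℓ} → Idx N ℓ × kent ℓ ≤ value ls → Below j ℓ
  in-bins ((1≤ℓ , _) , kℓ≤) = 1≤ℓ , bin-bound 1≤ℓ (≤-<-trans kℓ≤ (subst (_< cap j) (sym value≡m) m<))

a-odd : ∀ {a} → IsKentucky2 a → ∀ n → a (2 * n + 1) ≡ cap (suc n)
a-odd {a} K n = begin
  a (2 * n + 1)  ≡⟨ cong a (odd n) ⟩
  a (ix₁ n)      ≡⟨ agree K (ix₁ n) (ix₁ n) (s≤s z≤n) ≤-refl ⟩
  kent (ix₁ n)   ≡⟨ kent-ix₁ n ⟩
  cap (suc n)    ∎
  where
  open ≡-Reasoning
  odd : ∀ n → 2 * n + 1 ≡ ix₁ n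
  odd zero = refl
  odd (suc n) = trans (shift n) (cong (suc ∘ suc) (odd n))
    where
    shift : ∀ n → 2 * suc n + 1 ≡ suc (suc (2 * n + 1))
    shift = solve-∀

sum-of-counts : ∀ {a} → IsKentucky2 a → (s : ℕ → ℕ) →
  (∀ m → Σ ℕ λ N → Σ (List ℕ) λ ls → LegalDecomp a N m ls × (length ls ≡ s m)) →
  ∀ n → sum (map s (upTo (cap (suc n)))) ≡ total (suc n)
sum-of-counts K s s-counts n = trans (sum-upTo s (cap (suc n))) (sumBelow-cong (cap (suc n)) count)
  where
  count : ∀ m → m < cap (suc n) → s m ≡ summands (suc n) m
  count m m< = let (_ , _ , decomp , len) = s-counts m in trans (sym len) (count-is-summands K {j = suc n} decomp m<)

total-close : ∀ n → Close (total (suc n)) n (cap (suc n))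
total-close n with parity n | total-closed n
... | inj₁ (e≡1 , o≡0) | closed
  rewrite e≡1 | o≡0 | *-identityʳ (n + 2) | *-zeroʳ (n + 2) | +-identityʳ ((3 * n + 2) * cap (suc n)) = inj₁ closed
... | inj₂ (e≡0 , o≡1) | closed
  rewrite e≡0 | o≡1 | *-identityʳ (n + 2) | *-zeroʳ (n + 2) | +-identityʳ (9 * total (suc n)) = inj₂ closed

-- The error (n + 2) / 9 cap (n + 1) is at most n / 2ⁿ, since 2ⁿ ≤ cap (n + 1).
room : ∀ n → 1 ≤ n → (n + 2) * 2 ^ n ≤ 9 * n * cap (suc n)
room n 1≤n = *-mono-≤ (+-monoʳ-≤ n (≤-trans (s≤s (s≤s z≤n)) (*-monoʳ-≤ 8 1≤n))) (pow≤cap n)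

proposition3p1 : (a : ℕ → ℕ) → IsKentucky2 a →
    (s : ℕ → ℕ) →
    (∀ m → Σ ℕ λ N → Σ (List ℕ) λ ls → LegalDecomp a N m ls × (length ls ≡ s m)) →
    Σ ℚ λ C → Σ ℕ λ n₀ → ∀ n → n₀ ≤ n →
      ∣ (sum (map s (upTo (a (2 * n + 1)))) // a (2 * n + 1))
        - ((n // 3) +ℚ (2 // 9)) ∣
        ≤ℚ C *ℚ (n // (2 ^ n))
proposition3p1 a K s s-counts = 1ℚ , 1 , estimate
  where
  estimate : ∀ n → 1 ≤ n →
    ∣ (sum (map s (upTo (a (2 * n + 1)))) // a (2 * n + 1)) - ((n // 3) +ℚ (2 // 9)) ∣ ≤ℚ 1ℚ *ℚ (n // (2 ^ n))
  estimate n 1≤n rewrite a-odd K n | sum-of-counts K s s-counts n | ℚP.*-identityˡ (n // (2 ^ n)) =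
    mean-estimate (total (suc n)) n (cap (suc n)) (2 ^ n) (cap-pos (suc n)) (m^n>0 2 n) (total-close n) (room n 1≤n)
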